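{- Let $k\ge4$ be an even integer and let $L$ be the set of all odd integers. Then there is a constant $c_k>0$ depending only on $k$ such that for infinitely many positive integers $N$ there exists a family $\mathcal{F}$ of $N$ sets of size $k$ such that $\mathcal{F}$ contains no $L$-clique of size $2^{k/2}+1$, yet the chromatic number of the associated graph $G_{\mathcal{F}}$ is at least $c_k\log N$.
   Context: Sets $F_1,\dots,F_t$ form an $L$-clique of size $t$ if $|F_i\cap F_j|\in L$ for all $i<j$. The graph $G_{\mathcal F}$ has vertex set $\mathcal F$, with distinct $F,F'$ adjacent iff $|F\cap F'|\in L$. -}

module Defs where

open import Data.Nat using (ℕ; suc; _*_)
open import Data.Nat.Divisibility using (_∣_)
open import Data.Fin using (Fin; _<_)
open import Data.Fin.Subset using (Subset; _∩_; ∣_∣)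
open import Data.Product using (Σ)
open import Function.Definitions using (Injective)
open import Relation.Binary.PropositionalEquality using (_≡_; _≢_)
open import Relation.Nullary using (¬_)

-- L = the set of odd integers (intersection sizes are naturals).
Odd : ℕ → Set
Odd n = Σ ℕ (λ r → n ≡ suc (2 * r))

record Family (N n : ℕ) : Set where
  field
    sets     : Fin N → Subset n
    distinct : Injective _≡_ _≡_ sets

open Family public

Uniform : ∀ {N n} → ℕ → Family N n → Set
Uniform k F = ∀ i → ∣ sets F i ∣ ≡ k

HasOddClique : ∀ {N n} → ℕ → Family N n → Set
HasOddClique {N} t F =
  Σ (Fin t → Fin N) λ g → Injective _≡_ _≡_ g ×'
    (∀ i j → i < j → Odd ∣ sets F (g i) ∩ sets F (g j) ∣)
  where
    open import Data.Product using () renaming (_×_ to _×'_)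

Adjacent : ∀ {N n} → Family N n → Fin N → Fin N → Set
Adjacent F i j = i ≢ j × Odd ∣ sets F i ∩ sets F j ∣
  where open import Data.Product using (_×_)

ProperColouring : ∀ {N n} → Family N n → ℕ → Set
ProperColouring {N} F q =
  Σ (Fin N → Fin q) λ c → ∀ i j → Adjacent F i j → c i ≢ c j

-- Shift graph: the vertices are intervals [A, B] ⊆ {0, …, 2n − 1}, and [A, B], [A′, B′] are
-- joined when one ends where the other starts (B = A′ or B′ = A).  It has no triangle, and a
-- proper q-colouring of the n² intervals [a, a + d + 1] (a, d < n) forces n ≤ 2^q: the set of
-- colours on intervals starting at a determines a, since for a < a′ the interval [a, a′]
-- shares its colour with some interval starting at a′.
--
-- Intervals become k-sets (k = m + 3, m odd) on 2n blocks of size m + 2: [A, B] takes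
-- s = {0, 1} in block A and e = {0} ∪ {2, …, m + 1} in block B.  As |s ∩ s| = 2, |e ∩ s| = 1
-- and |e ∩ e| = m + 1,
--   |S ∩ S′| = 2[A = A′] + [A = B′] + [B = A′] + (m + 1)[B = B′],
-- which is odd exactly when the intervals are joined.  Hence there is no odd clique of size
-- 3 ≤ 2^(k/2) + 1, while N = n² members need q ≥ (log₂ N) / 2 colours.

module Submission where

open import Defs
open import Data.Bool using (Bool; true)
open import Data.Nat using (ℕ; zero; suc; _≤_; _<_; _*_; _^_; _+_; _∸_; _/_; z≤n; s≤s; z<s)
open import Data.Nat.Properties
  using (+-identityʳ; +-suc; +-cancelˡ-≡; +-mono-≤; +-monoˡ-≤; *-comm; *-mono-≤; suc-injective;
         ≤-trans; ≤-reflexive; m<m+n; m≤m*n; m∸n≤m; m+[n∸m]≡n; ^-monoʳ-≤; ^-distribˡ-+-*; even≢odd;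
         +-0-commutativeMonoid)
open import Data.Nat.DivMod using (m≥n⇒m/n>0)
open import Data.Nat.Divisibility using (_∣_; divides; ∣m∣n⇒∣m+n; _∣0)
open import Data.Fin as Fin
  using (Fin; zero; suc; toℕ; fromℕ<; _↑ˡ_; combine; remQuot; punchIn; punchOut; funToFin; finToFun)
open import Data.Fin.Patterns using (0F; 1F; 2F)
open import Data.Fin.Properties
  using (_≟_; toℕ-injective; toℕ-fromℕ<; toℕ-↑ˡ; toℕ<n; ↑ˡ-injective; <-irrefl; <-trans; <⇒≢;
         <-cmp; punchInᵢ≢i; punchIn-injective; punchIn-punchOut; combine-injectiveˡ;
         remQuot-combine; finToFun-funToFin; injective⇒≤; any?; *↔×; 2↔Bool)
open import Data.Fin.Subset using (Subset; _∩_; ∣_∣; inside; outside; ⊤) renaming (⊥ to ∅)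
open import Data.Fin.Subset.Properties using (∩-idem; ∩-zeroˡ; ∩-zeroʳ; ∣⊥∣≡0; ∣⊤∣≡n)
open import Data.Vec using ([]; _∷_; _++_; concat; tabulate)
open import Data.Vec.Properties using (zipWith-++; ++-injectiveˡ; ++-injectiveʳ)
open import Algebra.Properties.CommutativeMonoid.Sum +-0-commutativeMonoid
  using (sum; sum-remove; sum-cong-≗; sum-replicate-zero)
open import Data.Product using (Σ; ∃; _×_; _,_; proj₁; proj₂; uncurry)
open import Data.Sum using (_⊎_; inj₁; inj₂)
open import Data.Empty using (⊥; ⊥-elim)
open import Function using (_∘_; Injective)
open import Function.Bundles using (Inverse; Injection)
open import Function.Properties.Inverse using (Inverse⇒Injection; ↔-sym)
open import Relation.Binary using (tri<; tri≈; tri>)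
open import Relation.Binary.PropositionalEquality
open import Relation.Nullary using (¬_; yes; no; does)
open import Relation.Nullary.Decidable using (dec-true)

private variable
  K W : ℕ

∣p++q∣≡∣p∣+∣q∣ : ∀ {m n} (p : Subset m) (q : Subset n) → ∣ p ++ q ∣ ≡ ∣ p ∣ + ∣ q ∣
∣p++q∣≡∣p∣+∣q∣ []            q = refl
∣p++q∣≡∣p∣+∣q∣ (inside ∷ p)  q = cong suc (∣p++q∣≡∣p∣+∣q∣ p q)
∣p++q∣≡∣p∣+∣q∣ (outside ∷ p) q = ∣p++q∣≡∣p∣+∣q∣ p q

blocks : (Fin W → Subset K) → Subset (W * K)
blocks f = concat (tabulate f)

blocks-∩ : (f g : Fin W → Subset K) → blocks f ∩ blocks g ≡ blocks (λ t → f t ∩ g t)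
blocks-∩ {zero}  f g = refl
blocks-∩ {suc W} f g = trans (zipWith-++ _ (f zero) _ (g zero) _)
                             (cong (f zero ∩ g zero ++_) (blocks-∩ (f ∘ suc) (g ∘ suc)))

∣blocks∣ : (f : Fin W → Subset K) → ∣ blocks f ∣ ≡ sum (λ t → ∣ f t ∣)
∣blocks∣ {zero}  f = refl
∣blocks∣ {suc W} f =
  trans (∣p++q∣≡∣p∣+∣q∣ (f zero) _) (cong (∣ f zero ∣ +_) (∣blocks∣ (f ∘ suc)))

blocks-injective : (f g : Fin W → Subset K) → blocks f ≡ blocks g → f ≗ g
blocks-injective {suc W} f g eq zero    = ++-injectiveˡ (f zero) (g zero) eq
blocks-injective {suc W} f g eq (suc t) =
  blocks-injective (f ∘ suc) (g ∘ suc) (++-injectiveʳ (f zero) (g zero) eq) t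

sum-supported-at : (h : Fin W → ℕ) (A : Fin W) → (∀ t → t ≢ A → h t ≡ 0) → sum h ≡ h A
sum-supported-at {suc W} h A h≡0 = begin
  sum h                          ≡⟨ sum-remove h ⟩
  h A + sum (h ∘ punchIn A)      ≡⟨ cong (h A +_) (sum-cong-≗ {W} (h≡0 _ ∘ punchInᵢ≢i A)) ⟩
  h A + sum {W} (λ _ → 0)        ≡⟨ cong (h A +_) (sum-replicate-zero W) ⟩
  h A + 0                        ≡⟨ +-identityʳ (h A) ⟩
  h A                            ∎
  where open ≡-Reasoning

sum-supported-on-pair : (h : Fin W → ℕ) {A B : Fin W} → A ≢ B →
  (∀ t → t ≢ A → t ≢ B → h t ≡ 0) → sum h ≡ h A + h B
sum-supported-on-pair {suc W} h {A} {B} A≢B h≡0 = begin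
  sum h                          ≡⟨ sum-remove h ⟩
  h A + sum (h ∘ punchIn A)      ≡⟨ cong (h A +_) (sum-supported-at (h ∘ punchIn A) B′ off-B′) ⟩
  h A + h (punchIn A B′)         ≡⟨ cong (λ t → h A + h t) (punchIn-punchOut A≢B) ⟩
  h A + h B                      ∎
  where
  open ≡-Reasoning
  B′ = punchOut A≢B
  off-B′ : ∀ j → j ≢ B′ → h (punchIn A j) ≡ 0
  off-B′ j j≢B′ = h≡0 _ (punchInᵢ≢i A j)
    (λ eq → j≢B′ (punchIn-injective A j B′ (trans eq (sym (punchIn-punchOut A≢B)))))

even⇒¬odd : ∀ {n} → 2 ∣ n → ¬ Odd n
even⇒¬odd (divides q n≡q*2) (r , n≡1+2r) =
  even≢odd q r (trans (*-comm 2 q) (trans (sym n≡q*2) n≡1+2r))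

odd⇒2∣suc : ∀ {m} → Odd m → 2 ∣ suc m
odd⇒2∣suc (r , refl) = divides (suc r) (cong (2 +_) (*-comm 2 r))

even-∩ : {x y : Subset K} → 2 ∣ ∣ x ∩ x ∣ → y ≡ x ⊎ y ≡ ∅ → 2 ∣ ∣ x ∩ y ∣
even-∩ x∩x-even (inj₁ refl) = x∩x-even
even-∩ {K} {x} _ (inj₂ refl) =
  subst (2 ∣_) (sym (trans (cong ∣_∣ (∩-zeroʳ x)) (∣⊥∣≡0 K))) (2 ∣0)

data _⇝_ {W : ℕ} : Fin W × Fin W → Fin W × Fin W → Set where
  adjoin : ∀ {A B A′ B′} → B ≡ A′ → (A , B) ⇝ (A′ , B′)

Linked : Fin W × Fin W → Fin W × Fin W → Set
Linked p q = p ⇝ q ⊎ q ⇝ p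

Increasing : Fin W × Fin W → Set
Increasing (A , B) = A Fin.< B

private variable
  p q r : Fin W × Fin W

⇝-start< : Increasing p → p ⇝ q → proj₁ p Fin.< proj₁ q
⇝-start< A<B (adjoin refl) = A<B

⇝-end< : Increasing q → p ⇝ q → proj₂ p Fin.< proj₂ q
⇝-end< A<B (adjoin refl) = A<B

⇝-sameStart : p ⇝ q → p ⇝ r → proj₁ q ≡ proj₁ r
⇝-sameStart (adjoin B≡A′) (adjoin B≡A″) = trans (sym B≡A′) B≡A″

⇝-sameEnd : q ⇝ p → r ⇝ p → proj₂ q ≡ proj₂ r
⇝-sameEnd (adjoin B′≡A) (adjoin B″≡A) = trans B′≡A (sym B″≡A)

-- Orient each link.  Either two of the pairs have a common predecessor (so equal starts) or a
-- common successor (so equal ends), which the link between them forbids, or the links form a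
-- cycle, along which the starts strictly increase.
noLinkedTriangle : Increasing p → Increasing q → Increasing r →
  Linked p q → Linked p r → Linked q r → ⊥
noLinkedTriangle ip iq ir (inj₁ p⇝q) (inj₁ p⇝r) (inj₁ q⇝r) =
  <-irrefl (⇝-sameStart p⇝q p⇝r) (⇝-start< iq q⇝r)
noLinkedTriangle ip iq ir (inj₁ p⇝q) (inj₁ p⇝r) (inj₂ r⇝q) =
  <-irrefl (⇝-sameStart p⇝r p⇝q) (⇝-start< ir r⇝q)
noLinkedTriangle ip iq ir (inj₂ q⇝p) (inj₂ r⇝p) (inj₁ q⇝r) =
  <-irrefl (⇝-sameEnd q⇝p r⇝p) (⇝-end< ir q⇝r)
noLinkedTriangle ip iq ir (inj₂ q⇝p) (inj₂ r⇝p) (inj₂ r⇝q) =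
  <-irrefl (⇝-sameEnd r⇝p q⇝p) (⇝-end< iq r⇝q)
noLinkedTriangle ip iq ir (inj₁ p⇝q) (inj₂ r⇝p) (inj₂ r⇝q) =
  <-irrefl (⇝-sameEnd r⇝q p⇝q) (⇝-end< ip r⇝p)
noLinkedTriangle ip iq ir (inj₂ q⇝p) (inj₁ p⇝r) (inj₁ q⇝r) =
  <-irrefl (⇝-sameStart q⇝p q⇝r) (⇝-start< ip p⇝r)
noLinkedTriangle ip iq ir (inj₁ p⇝q) (inj₂ r⇝p) (inj₁ q⇝r) =
  <-irrefl refl (<-trans (⇝-start< ip p⇝q) (<-trans (⇝-start< iq q⇝r) (⇝-start< ir r⇝p)))
noLinkedTriangle ip iq ir (inj₂ q⇝p) (inj₁ p⇝r) (inj₂ r⇝q) =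
  <-irrefl refl (<-trans (⇝-start< ip p⇝r) (<-trans (⇝-start< ir r⇝q) (⇝-start< iq q⇝p)))

module _ (u v : Subset K) where

  slot : Fin W × Fin W → Fin W → Subset K
  slot (A , B) t with t ≟ A | t ≟ B
  ... | yes _ | _     = u
  ... | no _  | yes _ = v
  ... | no _  | no _  = ∅

  pairSet : Fin W × Fin W → Subset (W * K)
  pairSet p = blocks (slot p)

  slot-start : (A B : Fin W) → slot (A , B) A ≡ u
  slot-start A B with A ≟ A
  ... | yes _   = refl
  ... | no A≢A = ⊥-elim (A≢A refl)

  slot-end : {A B : Fin W} → A ≢ B → slot (A , B) B ≡ v
  slot-end {A = A} {B} A≢B with B ≟ A | B ≟ B
  ... | yes B≡A | _       = ⊥-elim (A≢B (sym B≡A))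
  ... | no _    | yes _   = refl
  ... | no _    | no B≢B = ⊥-elim (B≢B refl)

  slot-outside : {A B t : Fin W} → t ≢ A → t ≢ B → slot (A , B) t ≡ ∅
  slot-outside {A = A} {B} {t} t≢A t≢B with t ≟ A | t ≟ B
  ... | yes t≡A | _       = ⊥-elim (t≢A t≡A)
  ... | no _    | yes t≡B = ⊥-elim (t≢B t≡B)
  ... | no _    | no _    = refl

  slot-off-end : {A B t : Fin W} → t ≢ B → slot (A , B) t ≡ u ⊎ slot (A , B) t ≡ ∅
  slot-off-end {A = A} {B} {t} t≢B with t ≟ A | t ≟ B
  ... | yes _ | _       = inj₁ refl
  ... | no _  | yes t≡B = ⊥-elim (t≢B t≡B)
  ... | no _  | no _    = inj₂ refl

  slot-off-start : {A B t : Fin W} → t ≢ A → slot (A , B) t ≡ v ⊎ slot (A , B) t ≡ ∅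
  slot-off-start {A = A} {B} {t} t≢A with t ≟ A | t ≟ B
  ... | yes t≡A | _     = ⊥-elim (t≢A t≡A)
  ... | no _    | yes _ = inj₁ refl
  ... | no _    | no _  = inj₂ refl

  slot≡u⇒start : u ≢ v → u ≢ ∅ → {A B t : Fin W} → slot (A , B) t ≡ u → t ≡ A
  slot≡u⇒start u≢v u≢∅ {A} {B} {t} eq with t ≟ A | t ≟ B
  ... | yes t≡A | _     = t≡A
  ... | no _    | yes _ = ⊥-elim (u≢v (sym eq))
  ... | no _    | no _  = ⊥-elim (u≢∅ (sym eq))

  slot≡v⇒end : u ≢ v → v ≢ ∅ → {A B t : Fin W} → slot (A , B) t ≡ v → t ≡ B
  slot≡v⇒end u≢v v≢∅ {A} {B} {t} eq with t ≟ A | t ≟ B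
  ... | yes _ | _       = ⊥-elim (u≢v eq)
  ... | no _  | yes t≡B = t≡B
  ... | no _  | no _    = ⊥-elim (v≢∅ (sym eq))

  ∣pairSet∩pairSet∣ : {A B : Fin W} (q : Fin W × Fin W) → A ≢ B →
    ∣ pairSet (A , B) ∩ pairSet q ∣ ≡ ∣ u ∩ slot q A ∣ + ∣ v ∩ slot q B ∣
  ∣pairSet∩pairSet∣ {A = A} {B} q A≢B = begin
    ∣ pairSet (A , B) ∩ pairSet q ∣
      ≡⟨ cong ∣_∣ (blocks-∩ (slot (A , B)) (slot q)) ⟩
    ∣ blocks (λ t → slot (A , B) t ∩ slot q t) ∣
      ≡⟨ ∣blocks∣ (λ t → slot (A , B) t ∩ slot q t) ⟩
    sum (λ t → ∣ slot (A , B) t ∩ slot q t ∣)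
      ≡⟨ sum-supported-on-pair _ A≢B vanishes ⟩
    ∣ slot (A , B) A ∩ slot q A ∣ + ∣ slot (A , B) B ∩ slot q B ∣
      ≡⟨ cong₂ (λ x y → ∣ x ∩ slot q A ∣ + ∣ y ∩ slot q B ∣) (slot-start A B) (slot-end A≢B) ⟩
    ∣ u ∩ slot q A ∣ + ∣ v ∩ slot q B ∣
      ∎
    where
    open ≡-Reasoning
    vanishes : ∀ t → t ≢ A → t ≢ B → ∣ slot (A , B) t ∩ slot q t ∣ ≡ 0
    vanishes t t≢A t≢B = begin
      ∣ slot (A , B) t ∩ slot q t ∣   ≡⟨ cong (λ x → ∣ x ∩ slot q t ∣) (slot-outside t≢A t≢B) ⟩
      ∣ ∅ ∩ slot q t ∣                ≡⟨ cong ∣_∣ (∩-zeroˡ (slot q t)) ⟩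
      ∣ ∅ {K} ∣                       ≡⟨ ∣⊥∣≡0 K ⟩
      0                               ∎

  ∣pairSet∣ : {A B : Fin W} → A ≢ B → ∣ pairSet (A , B) ∣ ≡ ∣ u ∣ + ∣ v ∣
  ∣pairSet∣ {A = A} {B} A≢B = begin
    ∣ pairSet (A , B) ∣
      ≡⟨ cong ∣_∣ (∩-idem (pairSet (A , B))) ⟨
    ∣ pairSet (A , B) ∩ pairSet (A , B) ∣
      ≡⟨ ∣pairSet∩pairSet∣ (A , B) A≢B ⟩
    ∣ u ∩ slot (A , B) A ∣ + ∣ v ∩ slot (A , B) B ∣
      ≡⟨ cong₂ (λ x y → ∣ u ∩ x ∣ + ∣ v ∩ y ∣) (slot-start A B) (slot-end A≢B) ⟩
    ∣ u ∩ u ∣ + ∣ v ∩ v ∣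
      ≡⟨ cong₂ (λ x y → ∣ x ∣ + ∣ y ∣) (∩-idem u) (∩-idem v) ⟩
    ∣ u ∣ + ∣ v ∣
      ∎
    where open ≡-Reasoning

  pairSet-injective : u ≢ v → u ≢ ∅ → v ≢ ∅ → {A B : Fin W} (q : Fin W × Fin W) → A ≢ B →
    pairSet (A , B) ≡ pairSet q → (A , B) ≡ q
  pairSet-injective u≢v u≢∅ v≢∅ {A} {B} q A≢B eq =
    cong₂ _,_ (slot≡u⇒start u≢v u≢∅ (trans (sym (same A)) (slot-start A B)))
              (slot≡v⇒end u≢v v≢∅ (trans (sym (same B)) (slot-end A≢B)))
    where
    same : slot (A , B) ≗ slot q
    same = blocks-injective (slot (A , B)) (slot q) eq

  odd-∩⇒linked : 2 ∣ ∣ u ∩ u ∣ → 2 ∣ ∣ v ∩ v ∣ → {A B A′ B′ : Fin W} → A ≢ B →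
    Odd ∣ pairSet (A , B) ∩ pairSet (A′ , B′) ∣ → Linked (A , B) (A′ , B′)
  odd-∩⇒linked u-even v-even {A} {B} {A′} {B′} A≢B odd with B ≟ A′ | B′ ≟ A
  ... | yes B≡A′ | _        = inj₁ (adjoin B≡A′)
  ... | no _     | yes B′≡A = inj₂ (adjoin B′≡A)
  ... | no B≢A′  | no B′≢A  = ⊥-elim (even⇒¬odd even odd)
    where
    even : 2 ∣ ∣ pairSet (A , B) ∩ pairSet (A′ , B′) ∣
    even = subst (2 ∣_) (sym (∣pairSet∩pairSet∣ (A′ , B′) A≢B))
             (∣m∣n⇒∣m+n (even-∩ u-even (slot-off-end (B′≢A ∘ sym)))
                         (even-∩ v-even (slot-off-start B≢A′)))

  adjoined⇒odd-∩ : Odd ∣ v ∩ u ∣ → {A B A′ B′ : Fin W} → A ≢ B → A ≢ A′ → A ≢ B′ → B ≡ A′ →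
    Odd ∣ pairSet (A , B) ∩ pairSet (A′ , B′) ∣
  adjoined⇒odd-∩ odd {A} {B} {A′} {B′} A≢B A≢A′ A≢B′ B≡A′ = subst Odd (sym count) odd
    where
    open ≡-Reasoning
    count : ∣ pairSet (A , B) ∩ pairSet (A′ , B′) ∣ ≡ ∣ v ∩ u ∣
    count = begin
      ∣ pairSet (A , B) ∩ pairSet (A′ , B′) ∣
        ≡⟨ ∣pairSet∩pairSet∣ (A′ , B′) A≢B ⟩
      ∣ u ∩ slot (A′ , B′) A ∣ + ∣ v ∩ slot (A′ , B′) B ∣
        ≡⟨ cong₂ (λ x y → ∣ u ∩ x ∣ + ∣ v ∩ y ∣) (slot-outside A≢A′ A≢B′)
                 (trans (cong (slot (A′ , B′)) B≡A′) (slot-start A′ B′)) ⟩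
      ∣ u ∩ ∅ ∣ + ∣ v ∩ u ∣
        ≡⟨ cong (λ x → ∣ x ∣ + ∣ v ∩ u ∣) (∩-zeroʳ u) ⟩
      ∣ ∅ {K} ∣ + ∣ v ∩ u ∣
        ≡⟨ cong (_+ ∣ v ∩ u ∣) (∣⊥∣≡0 K) ⟩
      ∣ v ∩ u ∣
        ∎

startBlock endBlock : (m : ℕ) → Subset (2 + m)
startBlock m = inside ∷ inside ∷ ∅
endBlock   m = inside ∷ outside ∷ ⊤

∣startBlock∣ : (m : ℕ) → ∣ startBlock m ∣ ≡ 2
∣startBlock∣ m = cong (2 +_) (∣⊥∣≡0 m)

∣endBlock∣ : (m : ℕ) → ∣ endBlock m ∣ ≡ 1 + m
∣endBlock∣ m = cong suc (∣⊤∣≡n m)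

∣endBlock∩startBlock∣ : (m : ℕ) → ∣ endBlock m ∩ startBlock m ∣ ≡ 1
∣endBlock∩startBlock∣ m = cong suc (trans (cong ∣_∣ (∩-zeroʳ (⊤ {m}))) (∣⊥∣≡0 m))

interval : ∀ {n} → Fin n → Fin n → Fin (n + n) × Fin (n + n)
interval {n} a d = a ↑ˡ n , fromℕ< {toℕ a + suc (toℕ d)} (+-mono-≤ (toℕ<n a) (toℕ<n d))

module _ {n : ℕ} where

  toℕ-start : (a d : Fin n) → toℕ (proj₁ (interval a d)) ≡ toℕ a
  toℕ-start a d = toℕ-↑ˡ a n

  toℕ-end : (a d : Fin n) → toℕ (proj₂ (interval a d)) ≡ toℕ a + suc (toℕ d)
  toℕ-end a d = toℕ-fromℕ< _

  interval-increasing : (a d : Fin n) → Increasing (interval a d)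
  interval-increasing a d = subst₂ _<_ (sym (toℕ-start a d)) (sym (toℕ-end a d)) (m<m+n (toℕ a) z<s)

  interval-injective : ∀ {a d a′ d′ : Fin n} → interval a d ≡ interval a′ d′ → (a , d) ≡ (a′ , d′)
  interval-injective {a} {d} {a′} {d′} eq with ↑ˡ-injective n a a′ (cong proj₁ eq)
  ... | refl = cong (a ,_) (toℕ-injective (suc-injective (+-cancelˡ-≡ (toℕ a) _ _ ends)))
    where
    ends : toℕ a + suc (toℕ d) ≡ toℕ a + suc (toℕ d′)
    ends = trans (sym (toℕ-end a d)) (trans (cong (toℕ ∘ proj₂) eq) (toℕ-end a d′))

  interval-reaches : ∀ {a a′ : Fin n} → a Fin.< a′ → ∃ λ d → proj₂ (interval a d) ≡ a′ ↑ˡ n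
  interval-reaches {a} {a′} a<a′ = d , toℕ-injective (begin
    toℕ (proj₂ (interval a d))                  ≡⟨ toℕ-end a d ⟩
    toℕ a + suc (toℕ d)                         ≡⟨ cong (λ x → toℕ a + suc x) (toℕ-fromℕ< gap<n) ⟩
    toℕ a + suc (toℕ a′ ∸ suc (toℕ a))          ≡⟨ +-suc (toℕ a) _ ⟩
    suc (toℕ a) + (toℕ a′ ∸ suc (toℕ a))        ≡⟨ m+[n∸m]≡n a<a′ ⟩
    toℕ a′                                      ≡⟨ toℕ-↑ˡ a′ n ⟨
    toℕ (a′ ↑ˡ n)                               ∎)
    where
    open ≡-Reasoning
    gap<n : toℕ a′ ∸ suc (toℕ a) < n
    gap<n = ≤-trans (s≤s (m∸n≤m (toℕ a′) (suc (toℕ a)))) (toℕ<n a′)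
    d = fromℕ< gap<n

n≤b^q⇒n*n≤b^[2*q] : ∀ {n b q} → n ≤ b ^ q → n * n ≤ b ^ (2 * q)
n≤b^q⇒n*n≤b^[2*q] {n} {b} {q} n≤b^q = ≤-trans (*-mono-≤ n≤b^q n≤b^q) (≤-reflexive (begin
  b ^ q * b ^ q    ≡⟨ ^-distribˡ-+-* b q q ⟨
  b ^ (q + q)      ≡⟨ cong (λ x → b ^ (q + x)) (+-identityʳ q) ⟨
  b ^ (2 * q)      ∎))
  where open ≡-Reasoning

OddTriangleFree : ∀ {N n} → Family N n → Set
OddTriangleFree F = ∀ i j k → Odd ∣ sets F i ∩ sets F j ∣ → Odd ∣ sets F i ∩ sets F k ∣ →
  Odd ∣ sets F j ∩ sets F k ∣ → ⊥

oddTriangleFree⇒¬HasOddClique : ∀ {N n} {F : Family N n} → OddTriangleFree F →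
  ∀ {t} → 3 ≤ t → ¬ HasOddClique t F
oddTriangleFree⇒¬HasOddClique free (s≤s (s≤s (s≤s _))) (g , _ , odd) =
  free (g 0F) (g 1F) (g 2F) (odd 0F 1F z<s) (odd 0F 2F z<s) (odd 1F 2F (s≤s z<s))

module IntervalFamily (m n : ℕ) where

  private
    u v : Subset (2 + m)
    u = startBlock m
    v = endBlock m

  member : Fin n × Fin n → Subset ((n + n) * (2 + m))
  member p = pairSet u v (uncurry interval p)

  coordinates : Fin (n * n) → Fin n × Fin n
  coordinates = remQuot {n} n

  ends-distinct : (p : Fin n × Fin n) → proj₁ (uncurry interval p) ≢ proj₂ (uncurry interval p)
  ends-distinct (a , d) = <⇒≢ (interval-increasing a d)

  family : Family (n * n) ((n + n) * (2 + m))
  family = record { sets = member ∘ coordinates ; distinct = member∘coordinates-injective }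
    where
    member∘coordinates-injective : Injective _≡_ _≡_ (member ∘ coordinates)
    member∘coordinates-injective eq = Injection.injective (Inverse⇒Injection (*↔× {n} {n}))
      (interval-injective (pairSet-injective u v (λ ()) (λ ()) (λ ()) _ (ends-distinct _) eq))

  uniform : Uniform (3 + m) family
  uniform i = trans (∣pairSet∣ u v (ends-distinct (coordinates i)))
                    (cong₂ _+_ (∣startBlock∣ m) (∣endBlock∣ m))

  oddTriangleFree : Odd m → OddTriangleFree family
  oddTriangleFree m-odd i j k odd-ij odd-ik odd-jk =
    noLinkedTriangle (increasing i) (increasing j) (increasing k)
                     (linked odd-ij) (linked odd-ik) (linked odd-jk)
    where
    increasing : ∀ i → Increasing (uncurry interval (coordinates i))
    increasing i = interval-increasing _ _
    u-even : 2 ∣ ∣ u ∩ u ∣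
    u-even = subst (2 ∣_) (sym (trans (cong ∣_∣ (∩-idem u)) (∣startBlock∣ m))) (divides 1 refl)
    v-even : 2 ∣ ∣ v ∩ v ∣
    v-even = subst (2 ∣_) (sym (trans (cong ∣_∣ (∩-idem v)) (∣endBlock∣ m))) (odd⇒2∣suc m-odd)
    linked : ∀ {i j} → Odd ∣ sets family i ∩ sets family j ∣ →
      Linked (uncurry interval (coordinates i)) (uncurry interval (coordinates j))
    linked {i} = odd-∩⇒linked u v u-even v-even (ends-distinct (coordinates i))

  adjoined⇒odd-member-∩ : ∀ {a a′ d d′ : Fin n} → a Fin.< a′ → proj₂ (interval a d) ≡ a′ ↑ˡ n →
    Odd ∣ member (a , d) ∩ member (a′ , d′) ∣
  adjoined⇒odd-member-∩ {a} {a′} {d} {d′} a<a′ end≡start =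
    adjoined⇒odd-∩ u v (subst Odd (sym (∣endBlock∩startBlock∣ m)) (0 , refl))
      (<⇒≢ (interval-increasing a d)) (<⇒≢ A<A′) (<⇒≢ (<-trans A<A′ (interval-increasing a′ d′)))
      end≡start
    where
    A<A′ : a ↑ˡ n Fin.< a′ ↑ˡ n
    A<A′ = subst₂ _<_ (sym (toℕ-start a d)) (sym (toℕ-start a′ d′)) a<a′

  module _ {q : ℕ} (c : Fin (n * n) → Fin q) (proper : ∀ i j → Adjacent family i j → c i ≢ c j) where

    colour : Fin n → Fin n → Fin q
    colour a d = c (combine a d)

    palette : Fin n → Fin q → Bool
    palette a x = does (any? λ d → colour a d ≟ x)

    palette-colour : (a d : Fin n) → palette a (colour a d) ≡ true
    palette-colour a d = dec-true (any? _) (d , refl)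

    palette⇒coloured : ∀ {a x} → palette a x ≡ true → ∃ λ d → colour a d ≡ x
    palette⇒coloured {a} {x} eq with any? (λ d → colour a d ≟ x) | eq
    ... | yes coloured | _ = coloured
    ... | no _         | ()

    member-combine : (a d : Fin n) → sets family (combine a d) ≡ member (a , d)
    member-combine a d = cong member (remQuot-combine a d)

    <⇒palette≉ : ∀ {a a′} → a Fin.< a′ → ¬ palette a ≗ palette a′
    <⇒palette≉ {a} {a′} a<a′ same with interval-reaches a<a′
    ... | d , reach with palette⇒coloured (trans (sym (same (colour a d))) (palette-colour a d))
    ... | d′ , colour≡ =
      proper (combine a d) (combine a′ d′) (distinctMembers , oddMembers) (sym colour≡)
      where
      distinctMembers : combine a d ≢ combine a′ d′
      distinctMembers eq = <⇒≢ a<a′ (combine-injectiveˡ a d a′ d′ eq)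
      oddMembers : Odd ∣ sets family (combine a d) ∩ sets family (combine a′ d′) ∣
      oddMembers = subst₂ (λ S S′ → Odd ∣ S ∩ S′ ∣)
                     (sym (member-combine a d)) (sym (member-combine a′ d′))
                     (adjoined⇒odd-member-∩ a<a′ reach)

    palette-injective : ∀ {a a′} → palette a ≗ palette a′ → a ≡ a′
    palette-injective {a} {a′} same with <-cmp a a′
    ... | tri< a<a′ _ _ = ⊥-elim (<⇒palette≉ a<a′ same)
    ... | tri≈ _ a≡a′ _ = a≡a′
    ... | tri> _ _ a′<a = ⊥-elim (<⇒palette≉ a′<a (sym ∘ same))

    paletteCode : Fin n → Fin (2 ^ q)
    paletteCode a = funToFin (Inverse.from 2↔Bool ∘ palette a)

    paletteCode-injective : Injective _≡_ _≡_ paletteCode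
    paletteCode-injective {a} {a′} eq = palette-injective λ x →
      Injection.injective (Inverse⇒Injection (↔-sym 2↔Bool)) (begin
        Inverse.from 2↔Bool (palette a x)    ≡⟨ finToFun-funToFin _ x ⟨
        finToFun (paletteCode a) x           ≡⟨ cong (λ y → finToFun y x) eq ⟩
        finToFun (paletteCode a′) x          ≡⟨ finToFun-funToFin _ x ⟩
        Inverse.from 2↔Bool (palette a′ x)   ∎)
      where open ≡-Reasoning

    n≤2^q : n ≤ 2 ^ q
    n≤2^q = injective⇒≤ paletteCode-injective

  n*n≤2^[2*q] : ∀ {q} → ProperColouring family q → n * n ≤ 2 ^ (2 * q)
  n*n≤2^[2*q] {q} (c , proper) = n≤b^q⇒n*n≤b^[2*q] {b = 2} {q} (n≤2^q c proper)

even≥4⇒3+odd : ∀ {k} → 4 ≤ k → 2 ∣ k → ∃ λ m → Odd m × k ≡ 3 + m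
even≥4⇒3+odd () (divides 0 refl)
even≥4⇒3+odd (s≤s (s≤s ())) (divides 1 refl)
even≥4⇒3+odd _ (divides (suc (suc e)) k≡) =
  suc (2 * e) , (e , refl) , trans k≡ (cong (4 +_) (*-comm e 2))

3≤2^[k/2]+1 : ∀ {k} → 2 ≤ k → 3 ≤ 2 ^ (k / 2) + 1
3≤2^[k/2]+1 2≤k = +-monoˡ-≤ 1 (^-monoʳ-≤ 2 (m≥n⇒m/n>0 2≤k))

mainTheorem16 : (k : ℕ) → 4 ≤ k → 2 ∣ k →
    Σ ℕ λ m → 1 ≤ m ×
      ((N₀ : ℕ) → Σ ℕ λ N → N₀ < N × Σ ℕ λ n → Σ (Family N n) λ F →
        Uniform k F ×
        ¬ HasOddClique (2 ^ (k / 2) + 1) F ×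
        ((q : ℕ) → ProperColouring F q → N ≤ 2 ^ (m * q)))
mainTheorem16 k 4≤k 2∣k with even≥4⇒3+odd 4≤k 2∣k
... | m , m-odd , refl = 2 , s≤s z≤n , λ N₀ → let open IntervalFamily m (suc N₀) in
  suc N₀ * suc N₀ , m≤m*n (suc N₀) (suc N₀) , _ , family ,
  uniform ,
  oddTriangleFree⇒¬HasOddClique {F = family} (oddTriangleFree m-odd)
    (3≤2^[k/2]+1 (≤-trans (s≤s (s≤s z≤n)) 4≤k)) ,
  λ q → n*n≤2^[2*q]
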